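{- Let $q\ge2$ and $n\ge1$ be integers with $q\le 2n$. Then under each of the scenarios $(*\bullet)$ and $(\bullet\bullet)$, every subset $\Phi\subseteq\mathcal{F}_q$ is $n$-cell implementable.
   Context: $[b\rangle=\{0,1,\ldots,b-1\}$. Let $\mathbb{B}=\{0,1\}$, $\mathbb{B}_\circ=\mathbb{B}$, $\mathbb{B}_*=\mathbb{B}\cup\{*\}$, $\mathbb{B}_\bullet=\mathbb{B}\cup\{*,\bullet\}$. Define $\mathrm{T}:\mathbb{B}_\bullet^2\to\mathbb{B}$ by $\mathrm{T}(u,\vartheta)=1$ if and only if $u=*$, or $\vartheta=*$, or $u=\vartheta\in\mathbb{B}$. $\mathcal{F}_q$ is the set of all functions $[q\rangle\to\mathbb{B}$. For $\alpha,\beta\in\{\circ,*,\bullet\}$, a subset $\Phi\subseteq\mathcal{F}_q$ is $n$-cell implementable under scenario $(\alpha\beta)$ if there exist mappings $\mathbf{u}=(u_j)_{j\in[n\rangle}:[q\rangle\to\mathbb{B}_\alpha^n$ and $\boldsymbol{\vartheta}=(\vartheta_j)_{j\in[n\rangle}:\Phi\to\mathbb{B}_\beta^n$ such that $f(x)=\bigwedge_{j\in[n\rangle}\mathrm{T}(u_j(x),\vartheta_j(f))$ for all $f\in\Phi$ and $x\in[q\rangle$. -}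

module Defs where

open import Data.Bool using (Bool; true; false; _∧_)
open import Data.Nat using (ℕ)
open import Data.Fin using (Fin)
open import Data.Unit using (⊤)
open import Data.Empty using (⊥)
open import Data.Product using (Σ)
import Level
open import Relation.Unary using (Pred; _∈_)
open import Relation.Binary.PropositionalEquality using (_≡_)

data Scenario : Set where
  ∘ₛ *ₛ •ₛ : Scenario

-- The largest alphabet B_• = B ∪ {*, •}; 0 ↦ s0, 1 ↦ s1
data Sym : Set where
  s0 s1 star bullet : Sym

InAlph : Scenario → Sym → Set
InAlph _  s0     = ⊤
InAlph _  s1     = ⊤
InAlph ∘ₛ star   = ⊥
InAlph *ₛ star   = ⊤
InAlph •ₛ star   = ⊤
InAlph ∘ₛ bullet = ⊥
InAlph *ₛ bullet = ⊥
InAlph •ₛ bullet = ⊤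

B : Scenario → Set
B α = Σ Sym (InAlph α)

T : Sym → Sym → Bool
T star   _      = true
T _      star   = true
T s0     s0     = true
T s1     s1     = true
T _      _      = false

F : ℕ → Set
F q = Fin q → Bool

⋀ : (n : ℕ) → (Fin n → Bool) → Bool
⋀ ℕ.zero    g = true
⋀ (ℕ.suc n) g = g Fin.zero ∧ ⋀ n (λ j → g (Fin.suc j))

-- Φ ⊆ F_q is n-cell implementable under scenario (αβ)
Implementable : (α β : Scenario) (q n : ℕ) → Pred (F q) Level.0ℓ → Set
Implementable α β q n Φ =
  Σ (Fin q → Fin n → B α) λ u →
  Σ ((f : F q) → f ∈ Φ → Fin n → B β) λ ϑ →
    (f : F q) (fΦ : f ∈ Φ) (x : Fin q) →
      f x ≡ ⋀ n (λ j → T (Σ.proj₁ (u x j)) (Σ.proj₁ (ϑ f fΦ j)))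

-- Cell j is made responsible for the two inputs 2j and 2j+1; this needs q ≤ 2n.
-- An input x in cell j is fed as the bit u_j(x) = x mod 2, and every other cell gets
-- u = *, so it accepts regardless of ϑ.  Over the alphabet {0,1,*,•} a single ϑ_j(f)
-- can encode an arbitrary truth table of that bit: * accepts both bits, a bit accepts
-- only itself, and • accepts neither.
module Submission where

open import Defs
open import Data.Nat using (ℕ; _≤_; _*_)
open import Data.Product using (_×_)
open import Level using (0ℓ)
open import Relation.Unary using (Pred; _∈_)

open import Data.Bool using (Bool; true; false; _∧_)
open import Data.Bool.Properties using (∧-identityʳ)
open import Data.Fin using (Fin; zero; suc; toℕ; fromℕ<; inject≤; combine; remQuot; _≟_)
open import Data.Fin.Properties using (toℕ<n; toℕ-fromℕ<; toℕ-inject≤; toℕ-injective; suc-injective; combine-remQuot)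
open import Data.Maybe using (Maybe; just; nothing; maybe)
import Data.Nat as ℕ
open import Data.Nat.Properties using (*-comm)
open import Data.Product using (_,_; proj₁; proj₂; uncurry)
open import Data.Unit using (tt)
open import Relation.Nullary using (yes; no; contradiction)
open import Relation.Binary.PropositionalEquality using (_≡_; _≢_; refl; sym; trans; cong; subst; module ≡-Reasoning)

inB• : ∀ s → InAlph •ₛ s
inB• s0     = tt
inB• s1     = tt
inB• star   = tt
inB• bullet = tt

bit : ∀ {α} → Fin 2 → B α
bit zero       = s0 , tt
bit (suc zero) = s1 , tt

truthTable : (Fin 2 → Bool) → Sym
truthTable t with t zero | t (suc zero)
... | true  | true  = star
... | true  | false = s0
... | false | true  = s1
... | false | false = bullet

T-bit-truthTable : ∀ {α} (b : Fin 2) (t : Fin 2 → Bool) →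
                   T (proj₁ (bit {α} b)) (truthTable t) ≡ t b
T-bit-truthTable zero       t with t zero | t (suc zero)
... | true  | true  = refl
... | true  | false = refl
... | false | true  = refl
... | false | false = refl
T-bit-truthTable (suc zero) t with t zero | t (suc zero)
... | true  | true  = refl
... | true  | false = refl
... | false | true  = refl
... | false | false = refl

⋀-true : ∀ n (g : Fin n → Bool) → (∀ j → g j ≡ true) → ⋀ n g ≡ true
⋀-true ℕ.zero    g all = refl
⋀-true (ℕ.suc n) g all rewrite all zero = ⋀-true n (λ j → g (suc j)) (λ j → all (suc j))

⋀-pick : ∀ n (g : Fin n → Bool) (i : Fin n) → (∀ j → j ≢ i → g j ≡ true) → ⋀ n g ≡ g i
⋀-pick (ℕ.suc n) g zero    others =
  trans (cong (g zero ∧_) (⋀-true n _ (λ j → others (suc j) (λ ())))) (∧-identityʳ _)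
⋀-pick (ℕ.suc n) g (suc i) others rewrite others zero (λ ()) =
  ⋀-pick n (λ j → g (suc j)) i (λ j j≢i → others (suc j) (λ eq → j≢i (suc-injective eq)))

restrict : ∀ {m} q → Fin m → Maybe (Fin q)
restrict q y with toℕ y ℕ.<? q
... | yes y<q = just (fromℕ< y<q)
... | no  _   = nothing

restrict-inject≤ : ∀ {q m} (x : Fin q) (q≤m : q ≤ m) → restrict q (inject≤ x q≤m) ≡ just x
restrict-inject≤ {q} x q≤m with toℕ (inject≤ x q≤m) ℕ.<? q
... | yes x<q = cong just (toℕ-injective (trans (toℕ-fromℕ< x<q) (toℕ-inject≤ x q≤m)))
... | no  x≮q = contradiction (subst (ℕ._< q) (sym (toℕ-inject≤ x q≤m)) (toℕ<n x)) x≮q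

module _ {α : Scenario} (star∈α : InAlph α star) {n : ℕ} where

  cellInput : (c : Fin n) → Fin 2 → Fin n → B α
  cellInput c b j with j ≟ c
  ... | yes _ = bit b
  ... | no  _ = star , star∈α

  T-cellInput-elsewhere : ∀ {c j} b v → j ≢ c → T (proj₁ (cellInput c b j)) v ≡ true
  T-cellInput-elsewhere {c} {j} b v j≢c with j ≟ c
  ... | yes j≡c = contradiction j≡c j≢c
  ... | no  _   = refl

  T-cellInput-here : ∀ c b v → T (proj₁ (cellInput c b c)) v ≡ T (proj₁ (bit {α} b)) v
  T-cellInput-here c b v with c ≟ c
  ... | yes _   = refl
  ... | no  c≢c = contradiction refl c≢c

  implementable-byCells : ∀ {q} (enc : Fin q → Fin n × Fin 2) (dec : Fin n × Fin 2 → Maybe (Fin q)) →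
                          (∀ x → dec (enc x) ≡ just x) →
                          (Φ : Pred (F q) 0ℓ) → Implementable α •ₛ q n Φ
  implementable-byCells {q} enc dec dec-enc Φ = u , ϑ , correct
    where
    table : F q → Fin n → Fin 2 → Bool
    table f j b = maybe f true (dec (j , b))

    u : Fin q → Fin n → B α
    u x = uncurry cellInput (enc x)

    ϑ : (f : F q) → f ∈ Φ → Fin n → B •ₛ
    ϑ f _ j = truthTable (table f j) , inB• _

    correct : ∀ f fΦ x → f x ≡ ⋀ n (λ j → T (proj₁ (u x j)) (proj₁ (ϑ f fΦ j)))
    correct f fΦ x = sym (begin
      ⋀ n (λ j → T (proj₁ (u x j)) (truthTable (table f j)))
        ≡⟨ ⋀-pick n _ c (λ j j≢c → T-cellInput-elsewhere b _ j≢c) ⟩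
      T (proj₁ (cellInput c b c)) (truthTable (table f c))
        ≡⟨ T-cellInput-here c b _ ⟩
      T (proj₁ (bit {α} b)) (truthTable (table f c))
        ≡⟨ T-bit-truthTable b (table f c) ⟩
      maybe f true (dec (c , b))
        ≡⟨ cong (maybe f true) (dec-enc x) ⟩
      f x ∎)
      where
      open ≡-Reasoning
      c = proj₁ (enc x)
      b = proj₂ (enc x)

proposition3 : (q n : ℕ) → 2 ≤ q → 1 ≤ n → q ≤ 2 * n →
    (Φ : Pred (F q) 0ℓ) →
    Implementable *ₛ •ₛ q n Φ × Implementable •ₛ •ₛ q n Φ
proposition3 q n _ _ q≤2n Φ = implementable-byCells tt enc dec dec-enc Φ
                            , implementable-byCells tt enc dec dec-enc Φ
  where
  q≤n*2 : q ≤ n * 2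
  q≤n*2 = subst (q ≤_) (*-comm 2 n) q≤2n

  enc : Fin q → Fin n × Fin 2
  enc x = remQuot 2 (inject≤ x q≤n*2)

  dec : Fin n × Fin 2 → Maybe (Fin q)
  dec (j , b) = restrict q (combine j b)

  dec-enc : ∀ x → dec (enc x) ≡ just x
  dec-enc x = trans (cong (restrict q) (combine-remQuot {n} 2 (inject≤ x q≤n*2))) (restrict-inject≤ x q≤n*2)
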